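{- Let $(U,\rho)$ be a finite metric space and $T$ a 2-HST of $U$ (as in the context). Let $C_0$ be the set of $k$ initial centers output by the NDP-HST initialization. Then $$\mathrm{cost}^{T}_k(U)\le 10\,\mathrm{OPT}^T_k(U).$$
   Context: $(U,\rho)$ is a finite metric space with $|U|=n$, minimum interpoint distance $1$ and diameter $\Delta$; $L=\log_2\Delta$ is assumed to be an integer. A 2-HST of $U$ is a rooted tree $T$ whose nodes are subsets (clusters) of $U$, obtained by recursive padded decompositions: the root has level $L$; the children of a node at level $i$ are at level $i-1$ and partition its cluster into pieces of diameter at most $\Delta/2^{L-i+1}$; the leaves are in one-to-one correspondence with the points of $U$. $h_v$ denotes the level of node $v$, $T(v)$ the subtree rooted at $v$. The tree metric $\rho^T(x,y)$ is the weighted path distance between the leaves of $x$ and $y$, where an edge joining a node at level $i$ to its child at level $i-1$ has weight $2^{i-1}$. NDP-HST initialization: for every node $v$ let $N_v=|U\cap T(v)|$ and $\mathrm{score}(v)=N_v\cdot 2^{h_v}$. Subtree search: start with $C_1=\emptyset$; while $|C_1|<k$, add to $C_1$ the $k-|C_1|$ highest-score nodes (never re-selecting nodes in $C_1$ or their ancestors), then remove from $C_1$ every node having a descendant in $C_1$; the final $C_1$ consists of $k$ nodes with pairwise disjoint subtrees. Leaf search: for each $v\in C_1$, repeatedly replace $v$ by its child $w$ with largest $N_w$ until a leaf is reached; $C_0$ is the set of the $k$ resulting leaf points. Costs: $\mathrm{cost}^T_k(U)=\sum_{y\in U}\min_{x\in C_0}\rho^T(x,y)$ and $\mathrm{OPT}^T_k(U)=\min_{F\subseteq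 U,|F|=k}\sum_{y\in U}\min_{x\in F}\rho^T(x,y)$.
   Formalization: The metric ρ takes rational values instead of real values. -}

module Defs where

open import Data.Nat as ℕ using (ℕ; zero; suc; _^_; _∸_; _⊓_; _≡ᵇ_)
open import Data.Bool using (Bool; true; false; not; _∧_)
open import Data.Fin using (Fin)
open import Data.Fin.Properties using () renaming (_≟_ to _≟F_)
open import Data.List using (List; []; _∷_; _++_; length; foldr; map; filterᵇ; allFin)
open import Data.List.Membership.Propositional using (_∈_; _∉_)
import Data.List.Membership.DecPropositional as DecMem
open import Data.List.Relation.Unary.All using (All)
open import Data.List.Relation.Unary.Unique.Propositional using (Unique)
open import Data.List.Relation.Binary.Pointwise using (Pointwise)
open import Data.List.Relation.Binary.Permutation.Propositional using (_↭_)
open import Data.Nat.ListAction using (sum)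
open import Data.Bool.ListAction using (any)
open import Data.Maybe using (Maybe; just; nothing; maybe)
open import Data.Product using (Σ; ∃; _×_; _,_; proj₁; proj₂)
open import Data.Integer using (+_)
open import Data.Rational using (ℚ; 0ℚ; 1ℚ; _/_; _≤_; _+_; _*_)
open import Relation.Nullary using (yes; no; ¬_)
open import Relation.Binary.PropositionalEquality using (_≡_; _≢_)

ℕ→ℚ : ℕ → ℚ
ℕ→ℚ m = (+ m) / 1

record IsMetric {n : ℕ} (ρ : Fin n → Fin n → ℚ) : Set where
  field
    nonneg   : ∀ x y → 0ℚ ≤ ρ x y
    refl0    : ∀ x → ρ x x ≡ 0ℚ
    sym      : ∀ x y → ρ x y ≡ ρ y x
    triangle : ∀ x y z → ρ x z ≤ ρ x y + ρ y z

record MinDistOne {n : ℕ} (ρ : Fin n → Fin n → ℚ) : Set where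
  field
    atLeast1 : ∀ x y → x ≢ y → 1ℚ ≤ ρ x y
    attained : Σ (Fin n) λ x → Σ (Fin n) λ y → x ≢ y × ρ x y ≡ 1ℚ

record Diameter {n : ℕ} (ρ : Fin n → Fin n → ℚ) (Δ : ℚ) : Set where
  field
    bounded  : ∀ x y → ρ x y ≤ Δ
    attained : Σ (Fin n) λ x → Σ (Fin n) λ y → ρ x y ≡ Δ

data HST (n : ℕ) : ℕ → Set where
  leaf : Fin n → HST n 0
  node : ∀ {i} → List (HST n i) → HST n (suc i)

mutual
  leaves : ∀ {n i} → HST n i → List (Fin n)
  leaves (leaf x)  = x ∷ []
  leaves (node cs) = leavesL cs

  leavesL : ∀ {n i} → List (HST n i) → List (Fin n)
  leavesL []       = []
  leavesL (c ∷ cs) = leaves c ++ leavesL cs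

N : ∀ {n i} → HST n i → ℕ
N t = length (leaves t)

-- nodes are addressed by paths (lists of child indices) from the root
Path : Set
Path = List ℕ

mutual
  subtreeAt : ∀ {n i} → HST n i → Path → Maybe (Σ ℕ (HST n))
  subtreeAt {i = i} t []      = just (i , t)
  subtreeAt (leaf _)  (_ ∷ _) = nothing
  subtreeAt (node cs) (j ∷ p) = subtreeAtL cs j p

  subtreeAtL : ∀ {n i} → List (HST n i) → ℕ → Path → Maybe (Σ ℕ (HST n))
  subtreeAtL []       _       _ = nothing
  subtreeAtL (c ∷ cs) zero    p = subtreeAt c p
  subtreeAtL (c ∷ cs) (suc j) p = subtreeAtL cs j p

record Is2HST {n L : ℕ} (ρ : Fin n → Fin n → ℚ) (Δ : ℚ) (t : HST n L) : Set where
  field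
    leavesBij : leaves t ↭ allFin n
    nonemptyKids : ∀ p {j} (cs : List (HST n j)) →
                   subtreeAt t p ≡ just (suc j , node cs) → cs ≢ []
    diam : ∀ (p : Path) (j : ℕ) (s : HST n j) → p ≢ [] →
           subtreeAt t p ≡ just (j , s) →
           ∀ x y → x ∈ leaves s → y ∈ leaves s →
           ρ x y * ℕ→ℚ (2 ^ (L ∸ j)) ≤ Δ

-- Tree metric: weighted path length, edge from level (suc i) to level i
-- has weight 2^i.

-- total weight from a leaf (level 0) up to its ancestor at level i
upW : ℕ → ℕ
upW zero    = 0
upW (suc i) = upW i ℕ.+ 2 ^ i

mutual
  ρT : ∀ {n i} → HST n i → Fin n → Fin n → ℕ
  ρT (leaf _)  x y = 0
  ρT (node cs) x y = ρTL cs x y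

  ρTL : ∀ {n i} → List (HST n i) → Fin n → Fin n → ℕ
  ρTL []                 x y = 0
  ρTL {i = i} (c ∷ cs) x y with DecMem._∈?_ _≟F_ x (leaves c) | DecMem._∈?_ _≟F_ y (leaves c)
  ... | yes _ | yes _ = ρT c x y
  ... | yes _ | no  _ = 2 ℕ.* upW (suc i)
  ... | no  _ | yes _ = 2 ℕ.* upW (suc i)
  ... | no  _ | no  _ = ρTL cs x y

minOver : ∀ {n} → List (Fin n) → (Fin n → ℕ) → ℕ
minOver []       f = 0
minOver (x ∷ xs) f = foldr (λ z m → f z ⊓ m) (f x) xs

costT : ∀ {n L} → HST n L → List (Fin n) → ℕ
costT {n} t C = sum (map (λ y → minOver C (λ x → ρT t x y)) (allFin n))

-- NDP-HST initialization (nondeterministic in tie-breaking)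

score : ∀ {n L} → HST n L → Path → ℕ
score t p = maybe (λ s → N (proj₂ s) ℕ.* 2 ^ proj₁ s) 0 (subtreeAt t p)

IsNode : ∀ {n L} → HST n L → Path → Set
IsNode t p = Σ (Σ ℕ (HST _)) λ s → subtreeAt t p ≡ just s

isProperPrefix : Path → Path → Bool
isProperPrefix []      []      = false
isProperPrefix []      (_ ∷ _) = true
isProperPrefix (_ ∷ _) []      = false
isProperPrefix (a ∷ p) (b ∷ q) = (a ≡ᵇ b) ∧ isProperPrefix p q

hasDescIn : List Path → Path → Bool
hasDescIn D v = any (isProperPrefix v) D

Cand : ∀ {n L} → HST n L → List Path → Path → Set
Cand t C v = IsNode t v × v ∉ C × hasDescIn C v ≡ false

record SubtreeStep {n L} (t : HST n L) (k : ℕ) (C C' : List Path) : Set where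
  field
    S        : List Path
    uniq     : Unique S
    size     : length S ≡ k ∸ length C
    admiss   : All (Cand t C) S
    highest  : ∀ s → s ∈ S → ∀ v → Cand t C v → v ∉ S → score t v ℕ.≤ score t s
    result   : C' ≡ filterᵇ (λ v → not (hasDescIn (C ++ S) v)) (C ++ S)

data SubtreeRun {n L} (t : HST n L) (k : ℕ) : List Path → Set where
  start : SubtreeRun t k []
  step  : ∀ {C C'} → SubtreeRun t k C → length C ℕ.< k →
          SubtreeStep t k C C' → SubtreeRun t k C'

SubtreeSearch : ∀ {n L} → HST n L → ℕ → List Path → Set
SubtreeSearch t k C1 = SubtreeRun t k C1 × ¬ (length C1 ℕ.< k)

data Greedy {n : ℕ} : ∀ {i} → HST n i → Fin n → Set where
  gleaf : ∀ x → Greedy (leaf x) x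
  gnode : ∀ {i} {cs : List (HST n i)} {c : HST n i} {x} →
          c ∈ cs → All (λ c' → N c' ℕ.≤ N c) cs →
          Greedy c x → Greedy (node cs) x

LeafSearch : ∀ {n L} → HST n L → List Path → List (Fin n) → Set
LeafSearch t C1 C0 =
  Pointwise (λ v x → Σ (Σ ℕ (HST _)) λ s →
                       subtreeAt t v ≡ just s × Greedy (proj₂ s) x) C1 C0

{-# OPTIONS --safe #-}
-- Let m be the least score of a node chosen by the subtree search. The search leaves every node
-- that is not an ancestor of a chosen node with score at most m, and the chosen nodes form an
-- antichain. Compare C0 with an arbitrary k-set F cluster by cluster, through the local cost of a
-- cluster x (each point of x pays its distance to the nearest center inside x, or the diameter of
-- x if there is none). By induction over the tree, for every cluster x meeting F,
--   localCost C0 x + 6 m · #(chosen nodes in x) ≤ 4 · localCost F x + 6 m · |F ∩ x|.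
-- Inside a chosen subtree every proper subtree has score at most m, so along the greedy leaf
-- search a light child costs at most 4 m, paid by its points of F, or no more than with F if it
-- has none; if the largest child misses F, a sibling meeting F is no costlier than it. Above the
-- chosen subtrees, a child that contains chosen nodes but no point of F is heavy, and F pays for
-- it in full. At the root there are k ≥ |F| chosen nodes, so cost(C0) ≤ 4 · cost(F).
module Submission where

open import Defs
open import Data.Nat using (ℕ; zero; suc; _+_; _*_; _^_; _≤_; _<_; z≤n; s≤s; _⊓_; _≟_; >-nonZero)
open import Data.Nat.Properties
open import Data.Nat.ListAction using (sum)
open import Data.Nat.ListAction.Properties using (sum-++; sum-↭)
open import Data.Nat.Tactic.RingSolver using (solve-∀)
open import Algebra.Properties.CommutativeSemigroup +-commutativeSemigroup using (x∙yz≈y∙xz; xy∙z≈xz∙y)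
open import Data.Bool using (Bool; true; false; not; T)
open import Data.Bool.Properties using (T-∧; T-not-≡)
open import Data.Fin using (Fin)
open import Data.Fin.Properties using () renaming (_≟_ to _≟F_)
open import Data.List using (List; []; _∷_; _++_; length; map; foldr; filter; filterᵇ; allFin; applyUpTo; concat)
open import Data.List.Properties
  using (length-++; map-++; ++-assoc; ++-identityʳ; ∷-injectiveˡ; ∷-injectiveʳ; ≡-dec;
         filter-++; filter-all; filter-none; filter-some; map-applyUpTo)
open import Data.List.Membership.Propositional using (_∈_; _∉_; find)
open import Data.List.Membership.Propositional.Properties
  using (∈-++⁻; ∈-++⁺ˡ; ∈-++⁺ʳ; ∈-∃++; ∈-filter⁻; ∈-filter⁺; ∈-allFin; ∈-concat⁺′; ∈-applyUpTo⁺)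
import Data.List.Membership.DecPropositional as DecMembership
open import Data.List.Relation.Unary.Any as Any using (Any; here; there)
open import Data.List.Relation.Unary.Any.Properties
  using (any⁺; any⁻) renaming (++⁺ˡ to Any-++⁺ˡ; ++⁺ʳ to Any-++⁺ʳ; ++⁻ to Any-++⁻)
import Data.List.Relation.Unary.All as All
open import Data.List.Relation.Unary.All.Properties
  using (¬Any⇒All¬) renaming (++⁻ˡ to All-++⁻ˡ; ++⁻ʳ to All-++⁻ʳ)
open import Data.List.Relation.Unary.Unique.Propositional using (Unique; []; _∷_)
open import Data.List.Relation.Unary.Unique.Propositional.Properties
  using (allFin⁺) renaming (filter⁺ to Unique-filter⁺; ++⁺ to Unique-++⁺)
open import Data.List.Relation.Binary.Pointwise using (Pointwise; []; _∷_)
open import Data.List.Relation.Binary.Pointwise.Properties using (Pointwise-length)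
open import Data.List.Relation.Binary.Permutation.Propositional using (_↭_; ↭-sym; ↭⇒↭ₛ)
open import Data.List.Relation.Binary.Permutation.Propositional.Properties using (∈-resp-↭; map⁺)
import Data.List.Relation.Binary.Permutation.Setoid.Properties as SetoidPermutation
open import Data.List.Extrema.Nat using (argmin; argmin-all; f[argmin]≤f[xs]; argmax; argmax-all; f[xs]≤f[argmax])
open import Data.Maybe using (just; maybe′)
open import Data.Product using (∃; ∃₂; _×_; _,_; proj₁; proj₂)
open import Data.Sum using (_⊎_; inj₁; inj₂; [_,_])
open import Data.Unit using (⊤; tt)
open import Function using (_∘_; Equivalence)
open import Relation.Nullary using (Dec; yes; no; ¬_; contradiction)
open import Relation.Nullary.Decidable using (T?; toSum)
open import Data.Rational using (ℚ)
open import Relation.Binary.PropositionalEquality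
  using (_≡_; refl; sym; trans; cong; cong₂; subst; setoid; module ≡-Reasoning)

module _ {a} {A : Set a} where

  Unique-++⁻ˡ : ∀ {xs ys : List A} → Unique (xs ++ ys) → Unique xs
  Unique-++⁻ˡ {[]}     _          = []
  Unique-++⁻ˡ {x ∷ xs} (x∉ ∷ u) = All-++⁻ˡ xs x∉ ∷ Unique-++⁻ˡ u

  Unique-++⁻ʳ : ∀ {xs ys : List A} → Unique (xs ++ ys) → Unique ys
  Unique-++⁻ʳ {[]}     u       = u
  Unique-++⁻ʳ {x ∷ xs} (_ ∷ u) = Unique-++⁻ʳ {xs} u

  Unique-++-disjoint : ∀ {xs ys : List A} {z} → Unique (xs ++ ys) → z ∈ xs → z ∉ ys
  Unique-++-disjoint {x ∷ xs} (x∉ ∷ _) (here refl) z∈ys = All.lookup (All-++⁻ʳ xs x∉) z∈ys refl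
  Unique-++-disjoint {x ∷ xs} (_ ∷ u)  (there z∈xs)    = Unique-++-disjoint u z∈xs

  length-≤-⊆ : ∀ {xs ys : List A} → Unique xs → (∀ {z} → z ∈ xs → z ∈ ys) → length xs ≤ length ys
  length-≤-⊆ {[]}     _         _   = z≤n
  length-≤-⊆ {x ∷ xs} (x∉ ∷ u) xs⊆ys with ∈-∃++ (xs⊆ys (here refl))
  ... | pre , post , refl = begin
      suc (length xs)               ≤⟨ s≤s (length-≤-⊆ u xs⊆rest) ⟩
      suc (length (pre ++ post))    ≡⟨ cong suc (length-++ pre) ⟩
      suc (length pre + length post) ≡⟨ +-suc (length pre) (length post) ⟨
      length pre + length (x ∷ post) ≡⟨ length-++ pre ⟨
      length (pre ++ x ∷ post)      ∎
    where
    open ≤-Reasoning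
    xs⊆rest : ∀ {z} → z ∈ xs → z ∈ pre ++ post
    xs⊆rest {z} z∈xs with ∈-++⁻ pre (xs⊆ys (there z∈xs))
    ... | inj₁ z∈pre          = ∈-++⁺ˡ z∈pre
    ... | inj₂ (here refl)    = contradiction refl (All.lookup x∉ z∈xs)
    ... | inj₂ (there z∈post) = ∈-++⁺ʳ pre z∈post

  length-concat : (xss : List (List A)) → length (concat xss) ≡ sum (map length xss)
  length-concat []         = refl
  length-concat (xs ∷ xss) = trans (length-++ xs) (cong (length xs +_) (length-concat xss))

  sum-map-cong : ∀ (f g : A → ℕ) {xs} → (∀ {x} → x ∈ xs → f x ≡ g x) →
                 sum (map f xs) ≡ sum (map g xs)
  sum-map-cong f g {[]}     _   = refl
  sum-map-cong f g {x ∷ xs} f≗g = cong₂ _+_ (f≗g (here refl)) (sum-map-cong f g (f≗g ∘ there))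

  sum-map-mono : ∀ (f g : A → ℕ) {xs} → (∀ {x} → x ∈ xs → f x ≤ g x) →
                 sum (map f xs) ≤ sum (map g xs)
  sum-map-mono f g {[]}     _   = z≤n
  sum-map-mono f g {x ∷ xs} f≤g = +-mono-≤ (f≤g (here refl)) (sum-map-mono f g (f≤g ∘ there))

  sum-map-const : ∀ w (xs : List A) → sum (map (λ _ → w) xs) ≡ length xs * w
  sum-map-const w []       = refl
  sum-map-const w (_ ∷ xs) = cong (w +_) (sum-map-const w xs)

  sum-map-extract : ∀ (f : A → ℕ) pre x post → sum (map f (pre ++ x ∷ post)) ≡ f x + sum (map f (pre ++ post))
  sum-map-extract f []        x post = refl
  sum-map-extract f (y ∷ pre) x post = begin
      f y + sum (map f (pre ++ x ∷ post))     ≡⟨ cong (f y +_) (sum-map-extract f pre x post) ⟩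
      f y + (f x + sum (map f (pre ++ post))) ≡⟨ x∙yz≈y∙xz (f y) (f x) _ ⟩
      f x + (f y + sum (map f (pre ++ post))) ∎
    where open ≡-Reasoning

  sum-map-remove : ∀ {x xs} → x ∈ xs →
                   ∃ λ ys → (∀ {y} → y ∈ ys → y ∈ xs) × (∀ {y} → y ∈ xs → y ≡ x ⊎ y ∈ ys) ×
                            (∀ (f : A → ℕ) → sum (map f xs) ≡ f x + sum (map f ys))
  sum-map-remove {x} x∈ with ∈-∃++ x∈
  ... | pre , post , refl = pre ++ post , into , from , λ f → sum-map-extract f pre x post
    where
    into : ∀ {y} → y ∈ pre ++ post → y ∈ pre ++ x ∷ post
    into y∈ = [ ∈-++⁺ˡ , ∈-++⁺ʳ pre ∘ there ] (∈-++⁻ pre y∈)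
    from : ∀ {y} → y ∈ pre ++ x ∷ post → y ≡ x ⊎ y ∈ pre ++ post
    from y∈ with ∈-++⁻ pre y∈
    ... | inj₁ y∈pre          = inj₂ (∈-++⁺ˡ y∈pre)
    ... | inj₂ (here refl)    = inj₁ refl
    ... | inj₂ (there y∈post) = inj₂ (∈-++⁺ʳ pre y∈post)

  length≥1⇒∃∈ : ∀ {xs : List A} → 1 ≤ length xs → ∃ λ x → x ∈ xs
  length≥1⇒∃∈ {x ∷ _} _ = x , here refl

Pointwise-∈ˡ : ∀ {a b r} {A : Set a} {B : Set b} {R : A → B → Set r} {xs ys} →
               Pointwise R xs ys → ∀ {x} → x ∈ xs → ∃ λ y → y ∈ ys × R x y
Pointwise-∈ˡ (r ∷ _)  (here refl) = _ , here refl , r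
Pointwise-∈ˡ (_ ∷ rs) (there x∈)  with Pointwise-∈ˡ rs x∈
... | y , y∈ , rxy = y , there y∈ , rxy

module _ {n} (f : Fin n → ℕ) where

  private
    fold : ℕ → List (Fin n) → ℕ
    fold = foldr (λ z m → f z ⊓ m)

    fold≤init : ∀ a xs → fold a xs ≤ a
    fold≤init a []       = ≤-refl
    fold≤init a (x ∷ xs) = ≤-trans (m⊓n≤n (f x) _) (fold≤init a xs)

    fold≤elem : ∀ a xs {z} → z ∈ xs → fold a xs ≤ f z
    fold≤elem a (x ∷ xs) (here refl) = m⊓n≤m (f x) _
    fold≤elem a (x ∷ xs) (there z∈)  = ≤-trans (m⊓n≤n (f x) _) (fold≤elem a xs z∈)

    ≤fold : ∀ {b} a xs → b ≤ a → (∀ {z} → z ∈ xs → b ≤ f z) → b ≤ fold a xs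
    ≤fold a []       b≤a _   = b≤a
    ≤fold a (x ∷ xs) b≤a b≤f = ⊓-glb (b≤f (here refl)) (≤fold a xs b≤a (b≤f ∘ there))

  minOver-≡ : ∀ {P b p} → (∀ {q} → q ∈ P → b ≤ f q) → p ∈ P → f p ≡ b → minOver P f ≡ b
  minOver-≡ {x ∷ xs} b≤ p∈ fp≡b = ≤-antisym (≤-trans (minOver≤ p∈) (≤-reflexive fp≡b))
                                             (≤fold (f x) xs (b≤ (here refl)) (b≤ ∘ there))
    where
    minOver≤ : ∀ {q} → q ∈ x ∷ xs → fold (f x) xs ≤ f q
    minOver≤ (here refl) = fold≤init (f x) xs
    minOver≤ (there q∈)  = fold≤elem (f x) xs q∈

_∈?_ : ∀ {n} (x : Fin n) (xs : List (Fin n)) → Dec (x ∈ xs)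
_∈?_ = DecMembership._∈?_ _≟F_

leavesL-∈ : ∀ {n i} {cs : List (HST n i)} {c x} → c ∈ cs → x ∈ leaves c → x ∈ leavesL cs
leavesL-∈ {cs = c ∷ cs} (here refl) x∈ = ∈-++⁺ˡ x∈
leavesL-∈ {cs = c ∷ cs} (there c∈)  x∈ = ∈-++⁺ʳ (leaves c) (leavesL-∈ c∈ x∈)

mutual
  leaves-subtreeAt : ∀ {n i h} (x : HST n i) r {y : HST n h} {z} →
                     subtreeAt x r ≡ just (h , y) → z ∈ leaves y → z ∈ leaves x
  leaves-subtreeAt x         []      refl z∈ = z∈
  leaves-subtreeAt (node cs) (j ∷ r) eq   z∈ = leaves-subtreeAtL cs j r eq z∈

  leaves-subtreeAtL : ∀ {n i h} (cs : List (HST n i)) j r {y : HST n h} {z} →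
                      subtreeAtL cs j r ≡ just (h , y) → z ∈ leaves y → z ∈ leavesL cs
  leaves-subtreeAtL (c ∷ cs) zero    r eq z∈ = ∈-++⁺ˡ (leaves-subtreeAt c r eq z∈)
  leaves-subtreeAtL (c ∷ cs) (suc j) r eq z∈ = ∈-++⁺ʳ (leaves c) (leaves-subtreeAtL cs j r eq z∈)

subtreeAtL-index< : ∀ {n i} (cs : List (HST n i)) j r {s} → subtreeAtL cs j r ≡ just s → j < length cs
subtreeAtL-index< (c ∷ cs) zero    r _  = s≤s z≤n
subtreeAtL-index< (c ∷ cs) (suc j) r eq = s≤s (subtreeAtL-index< cs j r eq)

Greedy⇒∈leaves : ∀ {n i} {x : HST n i} {g} → Greedy x g → g ∈ leaves x
Greedy⇒∈leaves (gleaf _)       = here refl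
Greedy⇒∈leaves (gnode c∈ _ gc) = leavesL-∈ c∈ (Greedy⇒∈leaves gc)

weight : ∀ {n h} → HST n h → ℕ
weight {h = h} x = N x * 2 ^ h

Meets : ∀ {n i} → List (Fin n) → HST n i → Set
Meets P x = Any (_∈ P) (leaves x)

meets? : ∀ {n i} (P : List (Fin n)) (x : HST n i) → Dec (Meets P x)
meets? P x = Any.any? (_∈? P) (leaves x)

Meets-node⁻ : ∀ {n i} {P : List (Fin n)} (cs : List (HST n i)) → Meets P (node cs) →
              ∃ λ w → w ∈ cs × Meets P w
Meets-node⁻ (c ∷ cs) meets with Any-++⁻ (leaves c) meets
... | inj₁ meets-c  = c , here refl , meets-c
... | inj₂ meets-cs with Meets-node⁻ cs meets-cs
...   | w , w∈ , meets-w = w , there w∈ , meets-w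

countIn : ∀ {n} → List (Fin n) → List (Fin n) → ℕ
countIn P xs = length (filter (_∈? P) xs)

countIn-++ : ∀ {n} (P xs ys : List (Fin n)) → countIn P (xs ++ ys) ≡ countIn P xs + countIn P ys
countIn-++ P xs ys = trans (cong length (filter-++ (_∈? P) xs ys)) (length-++ (filter (_∈? P) xs))

countIn≤length : ∀ {n} (P : List (Fin n)) {xs} → Unique xs → countIn P xs ≤ length P
countIn≤length P {xs} u =
  length-≤-⊆ (Unique-filter⁺ (_∈? P) u) (λ z∈ → proj₂ (∈-filter⁻ (_∈? P) {xs = xs} z∈))

Meets⇒countIn≥1 : ∀ {n i} {P : List (Fin n)} (x : HST n i) → Meets P x → 1 ≤ countIn P (leaves x)
Meets⇒countIn≥1 x = filter-some (_∈? _)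

¬Meets⇒countIn≡0 : ∀ {n i} {P : List (Fin n)} (x : HST n i) → ¬ Meets P x → countIn P (leaves x) ≡ 0
¬Meets⇒countIn≡0 x ¬meets = cong length (filter-none (_∈? _) (¬Any⇒All¬ (leaves x) ¬meets))

-- The tree distance between two leaves whose lowest common ancestor has level h (cf. ρTL).
lcaDist : ℕ → ℕ
lcaDist h = 2 * upW h

upW+1≡2^ : ∀ h → upW h + 1 ≡ 2 ^ h
upW+1≡2^ zero    = refl
upW+1≡2^ (suc h) = begin
    upW h + 2 ^ h + 1   ≡⟨ xy∙z≈xz∙y (upW h) (2 ^ h) 1 ⟩
    upW h + 1 + 2 ^ h   ≡⟨ cong (_+ 2 ^ h) (upW+1≡2^ h) ⟩
    2 ^ h + 2 ^ h       ≡⟨ cong (2 ^ h +_) (+-identityʳ (2 ^ h)) ⟨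
    2 * 2 ^ h           ∎
  where open ≡-Reasoning

lcaDist-mono : ∀ h → lcaDist h ≤ lcaDist (suc h)
lcaDist-mono h = *-monoʳ-≤ 2 (m≤m+n (upW h) (2 ^ h))

lcaDist≤ : ∀ h → lcaDist h ≤ 2 * 2 ^ h
lcaDist≤ h = *-monoʳ-≤ 2 (subst (upW h ≤_) (upW+1≡2^ h) (m≤m+n (upW h) 1))

2*2^≤lcaDist-suc : ∀ h → 2 * 2 ^ h ≤ lcaDist (suc h)
2*2^≤lcaDist-suc h = *-monoʳ-≤ 2 (m≤n+m (2 ^ h) (upW h))

lcaDist-suc≤ : ∀ h → lcaDist (suc h) ≤ 4 * 2 ^ h
lcaDist-suc≤ h = ≤-trans (lcaDist≤ (suc h)) (≤-reflexive (sym (*-assoc 2 2 (2 ^ h))))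

-- Local costs

mutual
  localDist : ∀ {n i} → List (Fin n) → HST n i → Fin n → ℕ
  localDist P (leaf _)  y = 0
  localDist P (node cs) y = localDistL P cs y

  localDistL : ∀ {n i} → List (Fin n) → List (HST n i) → Fin n → ℕ
  localDistL P []       y = 0
  localDistL P (c ∷ cs) y with y ∈? leaves c
  ... | yes _ = childDist P c y
  ... | no  _ = localDistL P cs y

  childDist : ∀ {n i} → List (Fin n) → HST n i → Fin n → ℕ
  childDist {i = i} P c y with meets? P c
  ... | yes _ = localDist P c y
  ... | no  _ = lcaDist (suc i)

mutual
  localCost : ∀ {n i} → List (Fin n) → HST n i → ℕ
  localCost P (leaf _)  = 0
  localCost P (node cs) = localCostL P cs

  localCostL : ∀ {n i} → List (Fin n) → List (HST n i) → ℕ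
  localCostL P []       = 0
  localCostL P (c ∷ cs) = childCost P c + localCostL P cs

  childCost : ∀ {n i} → List (Fin n) → HST n i → ℕ
  childCost {i = i} P c with meets? P c
  ... | yes _ = localCost P c
  ... | no  _ = N c * lcaDist (suc i)

module _ {n i} {P : List (Fin n)} (c : HST n i) where

  childCost-meets : Meets P c → childCost P c ≡ localCost P c
  childCost-meets meets with meets? P c
  ... | yes _     = refl
  ... | no ¬meets = contradiction meets ¬meets

  childCost-misses : ¬ Meets P c → childCost P c ≡ N c * lcaDist (suc i)
  childCost-misses ¬meets with meets? P c
  ... | yes meets = contradiction meets ¬meets
  ... | no _      = refl

  childDist-meets : ∀ {y} → Meets P c → childDist P c y ≡ localDist P c y
  childDist-meets meets with meets? P c
  ... | yes _     = refl
  ... | no ¬meets = contradiction meets ¬meets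

  childDist-misses : ∀ {y} → ¬ Meets P c → childDist P c y ≡ lcaDist (suc i)
  childDist-misses ¬meets with meets? P c
  ... | yes meets = contradiction meets ¬meets
  ... | no _      = refl

module _ {n i} (c : HST n i) (cs : List (HST n i)) {y : Fin n} where

  localDistL-here : ∀ {P} → y ∈ leaves c → localDistL P (c ∷ cs) y ≡ childDist P c y
  localDistL-here y∈ with y ∈? leaves c
  ... | yes _  = refl
  ... | no y∉ = contradiction y∈ y∉

  localDistL-there : ∀ {P} → y ∉ leaves c → localDistL P (c ∷ cs) y ≡ localDistL P cs y
  localDistL-there y∉ with y ∈? leaves c
  ... | yes y∈ = contradiction y∈ y∉
  ... | no _   = refl

  module _ {p : Fin n} where

    ρTL-inside : p ∈ leaves c → y ∈ leaves c → ρTL (c ∷ cs) p y ≡ ρT c p y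
    ρTL-inside p∈ y∈ with p ∈? leaves c | y ∈? leaves c
    ... | yes _ | yes _  = refl
    ... | no p∉ | _      = contradiction p∈ p∉
    ... | yes _ | no y∉ = contradiction y∈ y∉

    ρTL-leaving : p ∈ leaves c → y ∉ leaves c → ρTL (c ∷ cs) p y ≡ lcaDist (suc i)
    ρTL-leaving p∈ y∉ with p ∈? leaves c | y ∈? leaves c
    ... | yes _ | no _   = refl
    ... | no p∉ | _      = contradiction p∈ p∉
    ... | yes _ | yes y∈ = contradiction y∈ y∉

    ρTL-entering : p ∉ leaves c → y ∈ leaves c → ρTL (c ∷ cs) p y ≡ lcaDist (suc i)
    ρTL-entering p∉ y∈ with p ∈? leaves c | y ∈? leaves c
    ... | no _   | yes _ = refl
    ... | yes p∈ | _     = contradiction p∈ p∉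
    ... | no _   | no y∉ = contradiction y∈ y∉

    ρTL-outside : p ∉ leaves c → y ∉ leaves c → ρTL (c ∷ cs) p y ≡ ρTL cs p y
    ρTL-outside p∉ y∉ with p ∈? leaves c | y ∈? leaves c
    ... | no _   | no _  = refl
    ... | yes p∈ | _     = contradiction p∈ p∉
    ... | no _   | yes y∈ = contradiction y∈ y∉

mutual
  localCost≤ : ∀ {n i} (P : List (Fin n)) (x : HST n i) → localCost P x ≤ N x * lcaDist i
  localCost≤ P (leaf _)  = z≤n
  localCost≤ P (node cs) = localCostL≤ P cs

  localCostL≤ : ∀ {n i} (P : List (Fin n)) (cs : List (HST n i)) →
                localCostL P cs ≤ length (leavesL cs) * lcaDist (suc i)
  localCostL≤ P []       = z≤n
  localCostL≤ {i = i} P (c ∷ cs) = begin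
      childCost P c + localCostL P cs
        ≤⟨ +-mono-≤ (childCost≤ P c) (localCostL≤ P cs) ⟩
      N c * lcaDist (suc i) + length (leavesL cs) * lcaDist (suc i)
        ≡⟨ *-distribʳ-+ (lcaDist (suc i)) (N c) _ ⟨
      (N c + length (leavesL cs)) * lcaDist (suc i)
        ≡⟨ cong (_* lcaDist (suc i)) (length-++ (leaves c)) ⟨
      length (leaves c ++ leavesL cs) * lcaDist (suc i) ∎
    where open ≤-Reasoning

  childCost≤ : ∀ {n i} (P : List (Fin n)) (c : HST n i) → childCost P c ≤ N c * lcaDist (suc i)
  childCost≤ {i = i} P c with meets? P c
  ... | yes _ = ≤-trans (localCost≤ P c) (*-monoʳ-≤ (N c) (lcaDist-mono i))
  ... | no _  = ≤-refl

mutual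
  localDist≤ : ∀ {n i} (P : List (Fin n)) (x : HST n i) y → localDist P x y ≤ lcaDist i
  localDist≤ P (leaf _)  y = z≤n
  localDist≤ P (node cs) y = localDistL≤ P cs y

  localDistL≤ : ∀ {n i} (P : List (Fin n)) (cs : List (HST n i)) y → localDistL P cs y ≤ lcaDist (suc i)
  localDistL≤ P []       y = z≤n
  localDistL≤ P (c ∷ cs) y with y ∈? leaves c
  ... | yes _ = childDist≤ P c y
  ... | no _  = localDistL≤ P cs y

  childDist≤ : ∀ {n i} (P : List (Fin n)) (c : HST n i) y → childDist P c y ≤ lcaDist (suc i)
  childDist≤ {i = i} P c y with meets? P c
  ... | yes _ = ≤-trans (localDist≤ P c y) (lcaDist-mono i)
  ... | no _  = ≤-refl

mutual
  localDist≤ρT : ∀ {n i} {P : List (Fin n)} (x : HST n i) y {p} → p ∈ P → localDist P x y ≤ ρT x p y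
  localDist≤ρT (leaf _)  y p∈ = z≤n
  localDist≤ρT (node cs) y p∈ = localDistL≤ρTL cs y p∈

  localDistL≤ρTL : ∀ {n i} {P : List (Fin n)} (cs : List (HST n i)) y {p} → p ∈ P →
                   localDistL P cs y ≤ ρTL cs p y
  localDistL≤ρTL []       y p∈ = z≤n
  localDistL≤ρTL {P = P} (c ∷ cs) y {p} p∈ with p ∈? leaves c | y ∈? leaves c
  ... | yes p∈c | yes _ = ≤-trans (≤-reflexive (childDist-meets c (Any.map (λ { refl → p∈ }) p∈c)))
                                   (localDist≤ρT c y p∈)
  ... | yes _   | no _  = localDistL≤ P cs y
  ... | no _    | yes _ = childDist≤ P c y
  ... | no _    | no _  = localDistL≤ρTL cs y p∈

localDistL-misses : ∀ {n i} {P : List (Fin n)} (cs : List (HST n i)) {y} → y ∈ leavesL cs →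
                    ¬ Any (_∈ P) (leavesL cs) → localDistL P cs y ≡ lcaDist (suc i)
localDistL-misses (c ∷ cs) {y} y∈ ¬meets with y ∈? leaves c
... | yes _  = childDist-misses c (¬meets ∘ Any-++⁺ˡ)
... | no y∉ with ∈-++⁻ (leaves c) y∈
...   | inj₁ y∈c  = contradiction y∈c y∉
...   | inj₂ y∈cs = localDistL-misses cs y∈cs (¬meets ∘ Any-++⁺ʳ (leaves c))

mutual
  localDist-attained : ∀ {n i} {P : List (Fin n)} (x : HST n i) {y} → Unique (leaves x) → y ∈ leaves x →
                       Meets P x → ∃ λ p → p ∈ P × p ∈ leaves x × ρT x p y ≡ localDist P x y
  localDist-attained (leaf z)  _ (here refl) (here z∈P) = z , z∈P , here refl , refl
  localDist-attained (node cs) u y∈ meets               = localDistL-attained cs u y∈ meets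

  localDistL-attained : ∀ {n i} {P : List (Fin n)} (cs : List (HST n i)) {y} → Unique (leavesL cs) →
                        y ∈ leavesL cs → Any (_∈ P) (leavesL cs) →
                        ∃ λ p → p ∈ P × p ∈ leavesL cs × ρTL cs p y ≡ localDistL P cs y
  localDistL-attained (c ∷ cs) u y∈ meets with ∈-++⁻ (leaves c) y∈
  ... | inj₁ y∈c  = attained-in-head c cs u y∈c meets
  ... | inj₂ y∈cs = attained-in-tail c cs u y∈cs meets

  attained-in-head : ∀ {n i} {P : List (Fin n)} (c : HST n i) cs {y} → Unique (leaves c ++ leavesL cs) →
                     y ∈ leaves c → Any (_∈ P) (leaves c ++ leavesL cs) →
                     ∃ λ p → p ∈ P × p ∈ leavesL (c ∷ cs) × ρTL (c ∷ cs) p y ≡ localDistL P (c ∷ cs) y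
  attained-in-head {P = P} c cs u y∈c meets with toSum (meets? P c)
  ... | inj₁ meets-c =
    let p , p∈P , p∈c , eq = localDist-attained c (Unique-++⁻ˡ u) y∈c meets-c
    in  p , p∈P , ∈-++⁺ˡ p∈c ,
        trans (ρTL-inside c cs p∈c y∈c)
              (trans eq (sym (trans (localDistL-here c cs y∈c) (childDist-meets c meets-c))))
  ... | inj₂ ¬meets-c with Any-++⁻ (leaves c) meets
  ...   | inj₁ meets-c  = contradiction meets-c ¬meets-c
  ...   | inj₂ meets-cs =
    let p , p∈cs , p∈P = find meets-cs
    in  p , p∈P , ∈-++⁺ʳ (leaves c) p∈cs ,
        trans (ρTL-entering c cs (λ p∈c → Unique-++-disjoint u p∈c p∈cs) y∈c)
              (sym (trans (localDistL-here c cs y∈c) (childDist-misses c ¬meets-c)))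

  attained-in-tail : ∀ {n i} {P : List (Fin n)} (c : HST n i) cs {y} → Unique (leaves c ++ leavesL cs) →
                     y ∈ leavesL cs → Any (_∈ P) (leaves c ++ leavesL cs) →
                     ∃ λ p → p ∈ P × p ∈ leavesL (c ∷ cs) × ρTL (c ∷ cs) p y ≡ localDistL P (c ∷ cs) y
  attained-in-tail {P = P} c cs u y∈cs meets with toSum (Any.any? (_∈? P) (leavesL cs))
  ... | inj₁ meets-cs =
    let p , p∈P , p∈cs , eq = localDistL-attained cs (Unique-++⁻ʳ {xs = leaves c} u) y∈cs meets-cs
    in  p , p∈P , ∈-++⁺ʳ (leaves c) p∈cs ,
        trans (ρTL-outside c cs (λ p∈c → Unique-++-disjoint u p∈c p∈cs) y∉c)
              (trans eq (sym (localDistL-there c cs y∉c)))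
    where y∉c = λ y∈c → Unique-++-disjoint u y∈c y∈cs
  ... | inj₂ ¬meets-cs with Any-++⁻ (leaves c) meets
  ...   | inj₂ meets-cs = contradiction meets-cs ¬meets-cs
  ...   | inj₁ meets-c  =
    let p , p∈c , p∈P = find meets-c
    in  p , p∈P , ∈-++⁺ˡ p∈c ,
        trans (ρTL-leaving c cs p∈c y∉c)
              (sym (trans (localDistL-there c cs y∉c) (localDistL-misses cs y∈cs ¬meets-cs)))
    where y∉c = λ y∈c → Unique-++-disjoint u y∈c y∈cs

mutual
  sum-localDist : ∀ {n i} (P : List (Fin n)) (x : HST n i) → Unique (leaves x) →
                  sum (map (localDist P x) (leaves x)) ≡ localCost P x
  sum-localDist P (leaf _)  _ = refl
  sum-localDist P (node cs) u = sum-localDistL P cs u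

  sum-localDistL : ∀ {n i} (P : List (Fin n)) (cs : List (HST n i)) → Unique (leavesL cs) →
                   sum (map (localDistL P cs) (leavesL cs)) ≡ localCostL P cs
  sum-localDistL P []       _ = refl
  sum-localDistL P (c ∷ cs) u = begin
      sum (map f (leaves c ++ leavesL cs))
        ≡⟨ cong sum (map-++ f (leaves c) (leavesL cs)) ⟩
      sum (map f (leaves c) ++ map f (leavesL cs))
        ≡⟨ sum-++ (map f (leaves c)) _ ⟩
      sum (map f (leaves c)) + sum (map f (leavesL cs))
        ≡⟨ cong₂ _+_ (sum-map-cong f (childDist P c) (localDistL-here c cs))
                     (sum-map-cong f (localDistL P cs) (λ y∈cs → localDistL-there c cs (disjoint y∈cs))) ⟩
      sum (map (childDist P c) (leaves c)) + sum (map (localDistL P cs) (leavesL cs))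
        ≡⟨ cong₂ _+_ (sum-childDist P c (Unique-++⁻ˡ u))
                     (sum-localDistL P cs (Unique-++⁻ʳ {xs = leaves c} u)) ⟩
      childCost P c + localCostL P cs ∎
    where
    open ≡-Reasoning
    f = localDistL P (c ∷ cs)
    disjoint : ∀ {y} → y ∈ leavesL cs → y ∉ leaves c
    disjoint y∈cs y∈c = Unique-++-disjoint u y∈c y∈cs

  sum-childDist : ∀ {n i} (P : List (Fin n)) (c : HST n i) → Unique (leaves c) →
                  sum (map (childDist P c) (leaves c)) ≡ childCost P c
  sum-childDist {i = i} P c u with meets? P c
  ... | yes _ = sum-localDist P c u
  ... | no _  = sum-map-const (lcaDist (suc i)) (leaves c)

Unique-leaves : ∀ {n L} {t : HST n L} → leaves t ↭ allFin n → Unique (leaves t)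
Unique-leaves {n} bij = Unique-resp-↭ (↭⇒↭ₛ (↭-sym bij)) (allFin⁺ n)
  where open SetoidPermutation (setoid (Fin n))

Meets-root : ∀ {n L} (t : HST n L) {P x} → leaves t ↭ allFin n → x ∈ P → Meets P t
Meets-root t bij x∈P = Any.map (λ { refl → x∈P }) (∈-resp-↭ (↭-sym bij) (∈-allFin _))

costT≡localCost : ∀ {n L} (t : HST n L) {P} → leaves t ↭ allFin n → Meets P t → costT t P ≡ localCost P t
costT≡localCost {n} t {P} bij meets = begin
    sum (map nearest (allFin n))         ≡⟨ sum-↭ (map⁺ nearest (↭-sym bij)) ⟩
    sum (map nearest (leaves t))         ≡⟨ sum-map-cong nearest (localDist P t) nearest≡localDist ⟩
    sum (map (localDist P t) (leaves t)) ≡⟨ sum-localDist P t (Unique-leaves {t = t} bij) ⟩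
    localCost P t                        ∎
  where
  open ≡-Reasoning
  nearest : Fin n → ℕ
  nearest y = minOver P (λ p → ρT t p y)
  nearest≡localDist : ∀ {y} → y ∈ leaves t → nearest y ≡ localDist P t y
  nearest≡localDist {y} y∈ =
    let p , p∈P , _ , eq = localDist-attained t (Unique-leaves {t = t} bij) y∈ meets
    in  minOver-≡ (λ p → ρT t p y) (λ q∈ → localDist≤ρT t y q∈) p∈P eq

infix 4 _⊑_ _⊏_ _⊑?_

_⊑_ : Path → Path → Set
p ⊑ v = ∃ λ r → v ≡ p ++ r

_⊏_ : Path → Path → Set
p ⊏ v = ∃₂ λ j r → v ≡ p ++ j ∷ r

⊑-refl : ∀ p → p ⊑ p
⊑-refl p = [] , sym (++-identityʳ p)

⊑-trans : ∀ {p q v} → p ⊑ q → q ⊑ v → p ⊑ v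
⊑-trans {p} (r , refl) (r′ , refl) = r ++ r′ , ++-assoc p r r′

⊏-⊑-trans : ∀ {p q v} → p ⊏ q → q ⊑ v → p ⊏ v
⊏-⊑-trans {p} (j , r , refl) (r′ , refl) = j , r ++ r′ , ++-assoc p (j ∷ r) r′

⊑-⊏-trans : ∀ {p q v} → p ⊑ q → q ⊏ v → p ⊏ v
⊑-⊏-trans {p} ([]    , refl) (j , r′ , refl) = j , r′ , cong (_++ j ∷ r′) (++-identityʳ p)
⊑-⊏-trans {p} (a ∷ r , refl) (j , r′ , refl) = a , r ++ j ∷ r′ , ++-assoc p (a ∷ r) (j ∷ r′)

⊏⇒⊑ : ∀ {p v} → p ⊏ v → p ⊑ v
⊏⇒⊑ (j , r , eq) = j ∷ r , eq

⊑⇒≡⊎⊏ : ∀ {p v} → p ⊑ v → v ≡ p ⊎ p ⊏ v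
⊑⇒≡⊎⊏ {p} ([]    , eq) = inj₁ (trans eq (++-identityʳ p))
⊑⇒≡⊎⊏     (j ∷ r , eq) = inj₂ (j , r , eq)

⊏-child : ∀ p j → p ⊏ p ++ j ∷ []
⊏-child p j = j , [] , refl

⊏⇒length< : ∀ {p v} → p ⊏ v → length p < length v
⊏⇒length< {p} (j , r , refl) = subst (length p <_) (sym (length-++ p)) (m<m+n (length p) (s≤s z≤n))

_⊑?_ : ∀ p v → Dec (p ⊑ v)
[]      ⊑? v       = yes (v , refl)
(a ∷ p) ⊑? []      = no λ { (_ , ()) }
(a ∷ p) ⊑? (b ∷ v) with a ≟ b | p ⊑? v
... | yes refl | yes (r , refl) = yes (r , refl)
... | no a≢b   | _              = no λ { (_ , eq) → a≢b (sym (∷-injectiveˡ eq)) }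
... | yes _    | no p⋢v         = no λ { (r , eq) → p⋢v (r , ∷-injectiveʳ eq) }

isProperPrefix⇒⊏ : ∀ p v → T (isProperPrefix p v) → p ⊏ v
isProperPrefix⇒⊏ []      (j ∷ r) _ = j , r , refl
isProperPrefix⇒⊏ (a ∷ p) (b ∷ v) t with Equivalence.to T-∧ t
... | a≡ᵇb , pv with ≡ᵇ⇒≡ a b a≡ᵇb | isProperPrefix⇒⊏ p v pv
...   | refl | j , r , refl = j , r , refl

⊏⇒isProperPrefix : ∀ p {v} → p ⊏ v → T (isProperPrefix p v)
⊏⇒isProperPrefix []      (j , r , refl) = tt
⊏⇒isProperPrefix (a ∷ p) (j , r , refl) =
  Equivalence.from T-∧ (≡⇒≡ᵇ a a refl , ⊏⇒isProperPrefix p (j , r , refl))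

module _ {D : List Path} {v : Path} where

  hasDescIn-false⇒ : hasDescIn D v ≡ false → ∀ {w} → w ∈ D → ¬ v ⊏ w
  hasDescIn-false⇒ eq w∈ v⊏w =
    subst T eq (any⁺ (isProperPrefix v) (Any.map (λ { refl → ⊏⇒isProperPrefix v v⊏w }) w∈))

  hasDescIn-false⇐ : (∀ {w} → w ∈ D → ¬ v ⊏ w) → hasDescIn D v ≡ false
  hasDescIn-false⇐ none with hasDescIn D v in eq
  ... | false = refl
  ... | true  =
    let w , w∈ , t = find (any⁻ (isProperPrefix v) D (subst T (sym eq) tt))
    in  contradiction (isProperPrefix⇒⊏ v w t) (none w∈)

-- The subtree search

record DominantAntichain {n L} (t : HST n L) (C : List Path) : Set where
  field
    unique    : Unique C
    antichain : ∀ {v w} → v ∈ C → w ∈ C → ¬ v ⊏ w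
    nodes     : ∀ {v} → v ∈ C → IsNode t v
    dominant  : ∀ {u} → IsNode t u → (∀ {v} → v ∈ C → ¬ u ⊑ v) →
                ∀ {v} → v ∈ C → score t u ≤ score t v

kept-extension : ∀ {Ls w} → w ∈ Ls → ∃ λ w′ → w′ ∈ filterᵇ (λ v → not (hasDescIn Ls v)) Ls × w ⊑ w′
kept-extension {Ls} {w} w∈ =
  w′ , ∈-filter⁺ (T? ∘ _) w′∈ (Equivalence.from T-not-≡ (hasDescIn-false⇐ maximal)) , w⊑w′
  where
  extensions = filter (w ⊑?_) Ls
  w′ = argmax length w extensions
  w′∈×w⊑w′ : w′ ∈ Ls × w ⊑ w′
  w′∈×w⊑w′ = argmax-all length (w∈ , ⊑-refl w) (All.tabulate (∈-filter⁻ (w ⊑?_)))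
  w′∈ = proj₁ w′∈×w⊑w′
  w⊑w′ = proj₂ w′∈×w⊑w′
  maximal : ∀ {u} → u ∈ Ls → ¬ w′ ⊏ u
  maximal u∈ w′⊏u = <⇒≱ (⊏⇒length< w′⊏u)
    (All.lookup (f[xs]≤f[argmax] w extensions) (∈-filter⁺ (w ⊑?_) u∈ (⊑-trans w⊑w′ (⊏⇒⊑ w′⊏u))))

module _ {n L} {t : HST n L} {k : ℕ} where

  step-dominant : ∀ {C C′} → DominantAntichain t C → (st : SubtreeStep t k C C′) →
                  ∀ {u} → IsNode t u → (∀ {w} → w ∈ C ++ SubtreeStep.S st → ¬ u ⊑ w) →
                  ∀ {v} → v ∈ C ++ SubtreeStep.S st → score t u ≤ score t v
  step-dominant {C} inv st {u} node-u outside v∈ with ∈-++⁻ C v∈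
  ... | inj₁ v∈C = DominantAntichain.dominant inv node-u (outside ∘ ∈-++⁺ˡ) v∈C
  ... | inj₂ v∈S = S.highest _ v∈S u (node-u , u∉C , no-desc) u∉S
    where
    module S = SubtreeStep st
    u∉C : u ∉ C
    u∉C u∈C = outside (∈-++⁺ˡ u∈C) (⊑-refl u)
    no-desc : hasDescIn C u ≡ false
    no-desc = hasDescIn-false⇐ λ w∈C u⊏w → outside (∈-++⁺ˡ {ys = S.S} w∈C) (⊏⇒⊑ u⊏w)
    u∉S : u ∉ S.S
    u∉S u∈S = outside (∈-++⁺ʳ C u∈S) (⊑-refl u)

  step-preserves : ∀ {C C′} → DominantAntichain t C → SubtreeStep t k C C′ → DominantAntichain t C′
  step-preserves {C} inv st rewrite SubtreeStep.result st = record
    { unique    = Unique-filter⁺ (T? ∘ keep)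
                    (Unique-++⁺ I.unique S.uniq λ (v∈C , v∈S) → candidate v∈S .proj₂ .proj₁ v∈C)
    ; antichain = λ v∈ w∈ → hasDescIn-false⇒ (kept⁻ v∈ .proj₂) (kept⁻ w∈ .proj₁)
    ; nodes     = λ v∈ → [ I.nodes , proj₁ ∘ candidate ] (∈-++⁻ C (kept⁻ v∈ .proj₁))
    ; dominant  = λ node-u above-none v∈ → step-dominant inv st node-u (not-below above-none) (kept⁻ v∈ .proj₁)
    }
    where
    module I = DominantAntichain inv
    module S = SubtreeStep st
    Ls = C ++ S.S
    keep : Path → Bool
    keep v = not (hasDescIn Ls v)
    kept⁻ : ∀ {v} → v ∈ filterᵇ keep Ls → v ∈ Ls × hasDescIn Ls v ≡ false
    kept⁻ v∈ = let v∈Ls , t = ∈-filter⁻ (T? ∘ keep) v∈ in v∈Ls , Equivalence.to T-not-≡ t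
    candidate : ∀ {v} → v ∈ S.S → Cand t C v
    candidate = All.lookup S.admiss
    not-below : ∀ {u} → (∀ {v} → v ∈ filterᵇ keep Ls → ¬ u ⊑ v) → ∀ {w} → w ∈ Ls → ¬ u ⊑ w
    not-below above-none w∈ u⊑w =
      let w′ , kept , w⊑w′ = kept-extension w∈ in above-none kept (⊑-trans u⊑w w⊑w′)

  run-invariant : ∀ {C} → SubtreeRun t k C → DominantAntichain t C
  run-invariant start             = record { unique = [] ; antichain = λ () ; nodes = λ () ; dominant = λ _ _ () }
  run-invariant (step run _ st) = step-preserves (run-invariant run) st

-- Bounds along a greedy descent

mutual
  LightBelow : ∀ {n h} → ℕ → HST n h → Set
  LightBelow m (leaf _)  = ⊤
  LightBelow m (node cs) = LightBelowL m cs

  LightBelowL : ∀ {n h} → ℕ → List (HST n h) → Set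
  LightBelowL m []       = ⊤
  LightBelowL m (c ∷ cs) = (weight c ≤ m × LightBelow m c) × LightBelowL m cs

LightBelowL-∈ : ∀ {n h m} {cs : List (HST n h)} {c} → c ∈ cs → LightBelowL m cs →
                weight c ≤ m × LightBelow m c
LightBelowL-∈ {cs = _ ∷ _} (here refl) (light-c , _) = light-c
LightBelowL-∈ {cs = _ ∷ _} (there c∈)  (_ , light)   = LightBelowL-∈ c∈ light

localCost-node : ∀ {n h} (P : List (Fin n)) (cs : List (HST n h)) →
                 localCost P (node cs) ≡ sum (map (childCost P) cs)
localCost-node P []       = refl
localCost-node P (c ∷ cs) = cong (childCost P c +_) (localCost-node P cs)

childCost≤4weight : ∀ {n h} (P : List (Fin n)) (c : HST n h) → childCost P c ≤ 4 * weight c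
childCost≤4weight {h = h} P c = begin
  childCost P c          ≤⟨ childCost≤ P c ⟩
  N c * lcaDist (suc h)  ≤⟨ *-monoʳ-≤ (N c) (lcaDist-suc≤ h) ⟩
  N c * (4 * 2 ^ h)      ≡⟨ swap (N c) (2 ^ h) ⟩
  4 * weight c           ∎
  where
  open ≤-Reasoning
  swap : ∀ a b → a * (4 * b) ≡ 4 * (a * b)
  swap = solve-∀

m≤m*n′ : ∀ a {b} → 1 ≤ b → a ≤ a * b
m≤m*n′ a {b} b≥1 = m≤m*n a b {{>-nonZero b≥1}}

module Bounds {n} (C0 F : List (Fin n)) (m : ℕ) where

  bound : ∀ {h} → HST n h → ℕ
  bound c = 4 * childCost F c + 6 * m * countIn F (leaves c)

  nodeBound : ∀ {h} → HST n h → ℕ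
  nodeBound x = 4 * localCost F x + 6 * m * countIn F (leaves x)

  bound-meets : ∀ {h} (c : HST n h) → Meets F c → bound c ≡ nodeBound c
  bound-meets c meets = cong (λ a → 4 * a + 6 * m * countIn F (leaves c)) (childCost-meets c meets)

  bound-misses : ∀ {h} (c : HST n h) → ¬ Meets F c → bound c ≡ 4 * (N c * lcaDist (suc h))
  bound-misses {h} c ¬meets = begin
    4 * childCost F c + 6 * m * countIn F (leaves c)
      ≡⟨ cong₂ (λ a b → 4 * a + 6 * m * b) (childCost-misses c ¬meets) (¬Meets⇒countIn≡0 c ¬meets) ⟩
    4 * (N c * lcaDist (suc h)) + 6 * m * 0
      ≡⟨ cong (4 * (N c * lcaDist (suc h)) +_) (*-zeroʳ (6 * m)) ⟩
    4 * (N c * lcaDist (suc h)) + 0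
      ≡⟨ +-identityʳ _ ⟩
    4 * (N c * lcaDist (suc h)) ∎
    where open ≡-Reasoning

  6m≤bound : ∀ {h} (c : HST n h) → Meets F c → 6 * m ≤ bound c
  6m≤bound c meets = ≤-trans (m≤m*n′ (6 * m) (Meets⇒countIn≥1 c meets)) (m≤n+m _ (4 * childCost F c))

  nodeBound-node : ∀ {h} (cs : List (HST n h)) → nodeBound (node cs) ≡ sum (map bound cs)
  nodeBound-node []       = *-zeroʳ (6 * m)
  nodeBound-node (c ∷ cs) = begin
      4 * (childCost F c + localCostL F cs) + 6 * m * countIn F (leaves c ++ leavesL cs)
        ≡⟨ cong (λ a → 4 * (childCost F c + localCostL F cs) + 6 * m * a) (countIn-++ F (leaves c) (leavesL cs)) ⟩
      4 * (childCost F c + localCostL F cs) + 6 * m * (countIn F (leaves c) + countIn F (leavesL cs))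
        ≡⟨ regroup (childCost F c) (localCostL F cs) m (countIn F (leaves c)) _ ⟩
      bound c + nodeBound (node cs)
        ≡⟨ cong (bound c +_) (nodeBound-node cs) ⟩
      bound c + sum (map bound cs) ∎
    where
    open ≡-Reasoning
    regroup : ∀ a b k x y → 4 * (a + b) + 6 * k * (x + y) ≡ (4 * a + 6 * k * x) + (4 * b + 6 * k * y)
    regroup = solve-∀

  light-bound : ∀ {h} (c : HST n h) → weight c ≤ m → childCost C0 c ≤ bound c
  light-bound {h} c light with toSum (meets? F c)
  ... | inj₁ meets = begin
      childCost C0 c ≤⟨ childCost≤4weight C0 c ⟩
      4 * weight c   ≤⟨ *-monoʳ-≤ 4 light ⟩
      4 * m          ≤⟨ *-monoˡ-≤ m (m≤m+n 4 2) ⟩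
      6 * m          ≤⟨ 6m≤bound c meets ⟩
      bound c        ∎
    where open ≤-Reasoning
  ... | inj₂ ¬meets = begin
      childCost C0 c              ≤⟨ childCost≤ C0 c ⟩
      N c * lcaDist (suc h)       ≤⟨ m≤n*m _ 4 ⟩
      4 * (N c * lcaDist (suc h)) ≡⟨ bound-misses c ¬meets ⟨
      bound c                     ∎
    where open ≤-Reasoning

  node-bound-via-child : ∀ {h} {cs : List (HST n h)} {c} → c ∈ cs → (∀ {w} → w ∈ cs → weight w ≤ m) →
                         childCost C0 c + 6 * m ≤ bound c → localCost C0 (node cs) + 6 * m ≤ nodeBound (node cs)
  node-bound-via-child {cs = cs} {c} c∈ light c-bound with sum-map-remove c∈
  ... | rest , rest⊆ , _ , split = begin
      localCost C0 (node cs) + 6 * m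
        ≡⟨ cong (_+ 6 * m) (trans (localCost-node C0 cs) (split (childCost C0))) ⟩
      childCost C0 c + sum (map (childCost C0) rest) + 6 * m
        ≡⟨ xy∙z≈xz∙y (childCost C0 c) _ (6 * m) ⟩
      childCost C0 c + 6 * m + sum (map (childCost C0) rest)
        ≤⟨ +-mono-≤ c-bound (sum-map-mono (childCost C0) bound λ {w} w∈ → light-bound w (light (rest⊆ w∈))) ⟩
      bound c + sum (map bound rest)
        ≡⟨ trans (nodeBound-node cs) (split bound) ⟨
      nodeBound (node cs) ∎
    where open ≤-Reasoning

  -- The largest child c misses F but a sibling w meets it: w costs at most what c costs with F,
  -- and the 6 m paid by w covers the bonus.
  node-bound-via-largest : ∀ {h} {cs : List (HST n h)} {c} → c ∈ cs → (∀ {w} → w ∈ cs → weight w ≤ m) →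
                           (∀ {w} → w ∈ cs → N w ≤ N c) → ¬ Meets F c → Meets F (node cs) →
                           localCost C0 (node cs) + 6 * m ≤ nodeBound (node cs)
  node-bound-via-largest {h} {cs} {c} c∈ light largest ¬meets-c meets
    with sum-map-remove c∈ | Meets-node⁻ cs meets
  ... | rest , rest⊆ , cs⊆ , split | w , w∈cs , meets-w with cs⊆ w∈cs
  ...   | inj₁ refl    = contradiction meets-w ¬meets-c
  ...   | inj₂ w∈rest with sum-map-remove w∈rest
  ...     | rest′ , rest′⊆ , _ , split′ = begin
      localCost C0 (node cs) + 6 * m
        ≡⟨ cong (_+ 6 * m) (trans (localCost-node C0 cs)
                                  (trans (split (childCost C0)) (cong (childCost C0 c +_) (split′ (childCost C0))))) ⟩
      childCost C0 c + (childCost C0 w + sum (map (childCost C0) rest′)) + 6 * m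
        ≤⟨ +-monoˡ-≤ (6 * m) (+-mono-≤ (childCost≤ C0 c) (+-mono-≤ w-cost rest′-cost)) ⟩
      K + (K + sum (map bound rest′)) + 6 * m
        ≡⟨ regroup K (sum (map bound rest′)) m ⟩
      2 * K + (6 * m + sum (map bound rest′))
        ≤⟨ +-mono-≤ (*-monoˡ-≤ K (m≤m+n 2 2)) (+-monoˡ-≤ _ (6m≤bound w meets-w)) ⟩
      4 * K + (bound w + sum (map bound rest′))
        ≡⟨ cong₂ _+_ (bound-misses c ¬meets-c) (split′ bound) ⟨
      bound c + sum (map bound rest)
        ≡⟨ trans (nodeBound-node cs) (split bound) ⟨
      nodeBound (node cs) ∎
    where
    open ≤-Reasoning
    K = N c * lcaDist (suc h)
    w-cost : childCost C0 w ≤ K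
    w-cost = ≤-trans (childCost≤ C0 w) (*-monoˡ-≤ (lcaDist (suc h)) (largest w∈cs))
    rest′-cost : sum (map (childCost C0) rest′) ≤ sum (map bound rest′)
    rest′-cost = sum-map-mono (childCost C0) bound (λ {v} v∈ → light-bound v (light (rest⊆ (rest′⊆ v∈))))
    regroup : ∀ a s k → a + (a + s) + 6 * k ≡ 2 * a + (6 * k + s)
    regroup = solve-∀

  greedy-bound : ∀ {h} (x : HST n h) {g} → LightBelow m x → Greedy x g → g ∈ C0 → Meets F x →
                 localCost C0 x + 6 * m ≤ nodeBound x
  greedy-bound (leaf z) _ (gleaf _) _ meets = m≤m*n′ (6 * m) (Meets⇒countIn≥1 (leaf z) meets)
  greedy-bound (node cs) light (gnode {c = c} c∈ largest greedy-c) g∈ meets with toSum (meets? F c)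
  ... | inj₂ ¬meets-c =
    node-bound-via-largest c∈ (λ w∈ → LightBelowL-∈ w∈ light .proj₁) (All.lookup largest) ¬meets-c meets
  ... | inj₁ meets-c  = node-bound-via-child c∈ (λ w∈ → LightBelowL-∈ w∈ light .proj₁) (begin
      childCost C0 c + 6 * m  ≡⟨ cong (_+ 6 * m) (childCost-meets c meets-C0) ⟩
      localCost C0 c + 6 * m  ≤⟨ greedy-bound c (LightBelowL-∈ c∈ light .proj₂) greedy-c g∈ meets-c ⟩
      nodeBound c             ≡⟨ bound-meets c meets-c ⟨
      bound c                 ∎)
    where
    open ≤-Reasoning
    meets-C0 : Meets C0 c
    meets-C0 = Any.map (λ { refl → g∈ }) (Greedy⇒∈leaves greedy-c)

-- Selected subtrees

module Potential {n L} (t : HST n L) {C1 : List Path} {C0 F : List (Fin n)}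
                (inv : DominantAntichain t C1) (leafSearch : LeafSearch t C1 C0) (m : ℕ)
                (m≤score : ∀ {v} → v ∈ C1 → m ≤ score t v)
                (score≤m : ∀ {u} → IsNode t u → (∀ {v} → v ∈ C1 → ¬ u ⊑ v) → score t u ≤ m) where

  open DominantAntichain inv
  open Bounds C0 F m

  record At {h} (x : HST n h) (p : Path) : Set where
    constructor at
    field subtreeAt-++ : ∀ q → subtreeAt t (p ++ q) ≡ subtreeAt x q

  record ChildrenAt {h} (cs : List (HST n h)) (f : ℕ → Path) : Set where
    constructor children-at
    field subtreeAt-++ : ∀ j q → subtreeAt t (f j ++ q) ≡ subtreeAtL cs j q

  At-root : At t []
  At-root = at λ _ → refl

  At⇒subtreeAt : ∀ {h} {x : HST n h} {p} → At x p → subtreeAt t p ≡ just (h , x)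
  At⇒subtreeAt {p = p} (at x-at) = trans (cong (subtreeAt t) (sym (++-identityʳ p))) (x-at [])

  At⇒score : ∀ {h} {x : HST n h} {p} → At x p → score t p ≡ weight x
  At⇒score x-at = cong (maybe′ (λ s → N (proj₂ s) * 2 ^ proj₁ s) 0) (At⇒subtreeAt x-at)

  At-children : ∀ {h} {cs : List (HST n h)} {p} → At (node cs) p → ChildrenAt cs (λ j → p ++ j ∷ [])
  At-children {p = p} (at x-at) =
    children-at λ j q → trans (cong (subtreeAt t) (++-assoc p (j ∷ []) q)) (x-at (j ∷ q))

  ChildrenAt-head : ∀ {h} {c : HST n h} {cs f} → ChildrenAt (c ∷ cs) f → At c (f 0)
  ChildrenAt-head (children-at cs-at) = at (cs-at 0)

  ChildrenAt-tail : ∀ {h} {c : HST n h} {cs f} → ChildrenAt (c ∷ cs) f → ChildrenAt cs (f ∘ suc)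
  ChildrenAt-tail (children-at cs-at) = children-at (cs-at ∘ suc)

  _∈C1? : ∀ p → Dec (p ∈ C1)
  p ∈C1? = DecMembership._∈?_ (≡-dec _≟_) p C1

  light : ∀ {h} {x : HST n h} {q} → At x q → (∀ {v} → v ∈ C1 → ¬ q ⊑ v) → weight x ≤ m
  light x-at none = subst (_≤ m) (At⇒score x-at) (score≤m (_ , At⇒subtreeAt x-at) none)

  greedy-at : ∀ {h} {x : HST n h} {p} → At x p → p ∈ C1 → ∃ λ g → g ∈ C0 × Greedy x g
  greedy-at x-at p∈ with Pointwise-∈ˡ leafSearch p∈
  ... | g , g∈ , s , eq , greedy with trans (sym (At⇒subtreeAt x-at)) eq
  ...   | refl = g , g∈ , greedy

  mutual
    lightBelow : ∀ {h} (x : HST n h) q → At x q → ∀ {v} → v ∈ C1 → v ⊑ q → LightBelow m x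
    lightBelow (leaf _)  q x-at v∈ v⊑q = tt
    lightBelow (node cs) q x-at v∈ v⊑q =
      lightBelowL cs (λ j → q ++ j ∷ []) (At-children x-at) v∈ (λ j → ⊑-⊏-trans v⊑q (⊏-child q j))

    lightBelowL : ∀ {h} (cs : List (HST n h)) f → ChildrenAt cs f → ∀ {v} → v ∈ C1 → (∀ j → v ⊏ f j) →
                  LightBelowL m cs
    lightBelowL []       _ _ _ _ = tt
    lightBelowL (c ∷ cs) f cs-at v∈ v⊏ =
      ( light (ChildrenAt-head cs-at) (λ w∈ f0⊑w → antichain v∈ w∈ (⊏-⊑-trans (v⊏ 0) f0⊑w))
      , lightBelow c (f 0) (ChildrenAt-head cs-at) v∈ (⊏⇒⊑ (v⊏ 0)) )
      , lightBelowL cs (f ∘ suc) (ChildrenAt-tail cs-at) v∈ (v⊏ ∘ suc)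

  below : Path → ℕ
  below p = length (filter (p ⊑?_) C1)

  below-root : below [] ≡ length C1
  below-root = cong length (filter-all ([] ⊑?_) {xs = C1} (All.tabulate (λ {v} _ → v , refl)))

  below≤1 : ∀ {p} → p ∈ C1 → below p ≤ 1
  below≤1 {p} p∈ = length-≤-⊆ (Unique-filter⁺ (p ⊑?_) unique) only-p
    where
    only-p : ∀ {v} → v ∈ filter (p ⊑?_) C1 → v ∈ p ∷ []
    only-p v∈ with ∈-filter⁻ (p ⊑?_) v∈
    ... | v∈C1 , p⊑v with ⊑⇒≡⊎⊏ p⊑v
    ...   | inj₁ v≡p = here v≡p
    ...   | inj₂ p⊏v = contradiction p⊏v (antichain p∈ v∈C1)

  below-leaf : ∀ {z p} → p ∉ C1 → At (leaf z) p → below p ≡ 0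
  below-leaf {p = p} p∉ x-at = cong length (filter-none (p ⊑?_) (All.tabulate not-below))
    where
    not-below : ∀ {v} → v ∈ C1 → ¬ p ⊑ v
    not-below v∈ p⊑v with ⊑⇒≡⊎⊏ p⊑v
    ... | inj₁ refl = p∉ v∈
    ... | inj₂ (j , r , refl) with trans (sym (At.subtreeAt-++ x-at (j ∷ r))) (nodes v∈ .proj₂)
    ...   | ()

  below-node : ∀ {h} {cs : List (HST n h)} {p} → p ∉ C1 → At (node cs) p →
               below p ≤ sum (applyUpTo (λ j → below (p ++ j ∷ [])) (length cs))
  below-node {cs = cs} {p} p∉ x-at = begin
      length (filter (p ⊑?_) C1)               ≤⟨ length-≤-⊆ (Unique-filter⁺ (p ⊑?_) unique) in-child ⟩
      length (concat (applyUpTo byChild (length cs))) ≡⟨ length-concat (applyUpTo byChild (length cs)) ⟩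
      sum (map length (applyUpTo byChild (length cs))) ≡⟨ cong sum (map-applyUpTo byChild length (length cs)) ⟩
      sum (applyUpTo (λ j → below (p ++ j ∷ [])) (length cs)) ∎
    where
    open ≤-Reasoning
    byChild : ℕ → List Path
    byChild j = filter ((p ++ j ∷ []) ⊑?_) C1
    in-child : ∀ {v} → v ∈ filter (p ⊑?_) C1 → v ∈ concat (applyUpTo byChild (length cs))
    in-child v∈ with ∈-filter⁻ (p ⊑?_) v∈
    ... | v∈C1 , p⊑v with ⊑⇒≡⊎⊏ p⊑v
    ...   | inj₁ refl = contradiction v∈C1 p∉
    ...   | inj₂ (j , r , refl) =
      ∈-concat⁺′ (∈-filter⁺ ((p ++ j ∷ []) ⊑?_) v∈C1 (r , sym (++-assoc p (j ∷ []) r)))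
                 (∈-applyUpTo⁺ byChild (subtreeAtL-index< cs j r
                   (trans (sym (At.subtreeAt-++ x-at (j ∷ r))) (nodes v∈C1 .proj₂))))

  below≡0⇒light : ∀ {h} {x : HST n h} {p} → At x p → below p ≡ 0 → weight x ≤ m
  below≡0⇒light {p = p} x-at none = light x-at λ v∈ p⊑v →
    <⇒≢ (filter-some (p ⊑?_) (Any.map (λ { refl → p⊑v }) v∈)) (sym none)

  below≥1⇒Meets : ∀ {h} (x : HST n h) {p} → At x p → 1 ≤ below p → Meets C0 x
  below≥1⇒Meets x {p} x-at some with length≥1⇒∃∈ {xs = filter (p ⊑?_) C1} some
  ... | v , v∈ with ∈-filter⁻ (p ⊑?_) v∈
  ...   | v∈C1 , (r , refl) with Pointwise-∈ˡ leafSearch v∈C1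
  ...     | g , g∈ , s , eq , greedy =
    Any.map (λ { refl → g∈ })
            (leaves-subtreeAt x r (trans (sym (At.subtreeAt-++ x-at r)) eq) (Greedy⇒∈leaves greedy))

  mutual
    heavy : ∀ {h} (x : HST n h) p → At x p → below p * m ≤ weight x
    heavy x p x-at with p ∈C1?
    ... | yes p∈ = begin
        below p * m  ≤⟨ *-monoˡ-≤ m (below≤1 p∈) ⟩
        1 * m        ≡⟨ *-identityˡ m ⟩
        m            ≤⟨ m≤score p∈ ⟩
        score t p    ≡⟨ At⇒score x-at ⟩
        weight x     ∎
      where open ≤-Reasoning
    heavy (leaf _) p x-at | no p∉ = ≤-trans (≤-reflexive (cong (_* m) (below-leaf p∉ x-at))) z≤n
    heavy {suc h} (node cs) p x-at | no p∉ = begin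
        below p * m
          ≤⟨ *-monoˡ-≤ m (below-node p∉ x-at) ⟩
        sum (applyUpTo (λ j → below (p ++ j ∷ [])) (length cs)) * m
          ≤⟨ heavyL cs _ (At-children x-at) ⟩
        length (leavesL cs) * 2 ^ h
          ≤⟨ *-monoʳ-≤ (length (leavesL cs)) (m≤n*m (2 ^ h) 2) ⟩
        weight (node cs) ∎
      where open ≤-Reasoning

    heavyL : ∀ {h} (cs : List (HST n h)) f → ChildrenAt cs f →
             sum (applyUpTo (below ∘ f) (length cs)) * m ≤ length (leavesL cs) * 2 ^ h
    heavyL []       f x-at = z≤n
    heavyL {h} (c ∷ cs) f cs-at = begin
        (below (f 0) + sum (applyUpTo (below ∘ f ∘ suc) (length cs))) * m
          ≡⟨ *-distribʳ-+ m (below (f 0)) _ ⟩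
        below (f 0) * m + sum (applyUpTo (below ∘ f ∘ suc) (length cs)) * m
          ≤⟨ +-mono-≤ (heavy c (f 0) (ChildrenAt-head cs-at)) (heavyL cs (f ∘ suc) (ChildrenAt-tail cs-at)) ⟩
        N c * 2 ^ h + length (leavesL cs) * 2 ^ h
          ≡⟨ *-distribʳ-+ (2 ^ h) (N c) _ ⟨
        (N c + length (leavesL cs)) * 2 ^ h
          ≡⟨ cong (_* 2 ^ h) (length-++ (leaves c)) ⟨
        length (leaves c ++ leavesL cs) * 2 ^ h ∎
      where open ≤-Reasoning

  mutual
    potential : ∀ {h} (x : HST n h) p → At x p → Meets F x → localCost C0 x + 6 * m * below p ≤ nodeBound x
    potential x p x-at meets with p ∈C1?
    ... | no p∉  = potential-above x p x-at p∉
    ... | yes p∈ with greedy-at x-at p∈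
    ...   | g , g∈ , greedy = begin
        localCost C0 x + 6 * m * below p ≤⟨ +-monoʳ-≤ (localCost C0 x) (*-monoʳ-≤ (6 * m) (below≤1 p∈)) ⟩
        localCost C0 x + 6 * m * 1       ≡⟨ cong (localCost C0 x +_) (*-identityʳ (6 * m)) ⟩
        localCost C0 x + 6 * m           ≤⟨ greedy-bound x (lightBelow x p x-at p∈ (⊑-refl p)) greedy g∈ meets ⟩
        nodeBound x                      ∎
      where open ≤-Reasoning

    potential-above : ∀ {h} (x : HST n h) p → At x p → p ∉ C1 → localCost C0 x + 6 * m * below p ≤ nodeBound x
    potential-above (leaf _)  p x-at p∉ =
      ≤-trans (≤-reflexive (trans (cong (6 * m *_) (below-leaf p∉ x-at)) (*-zeroʳ (6 * m)))) z≤n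
    potential-above (node cs) p x-at p∉ =
      ≤-trans (+-monoʳ-≤ (localCostL C0 cs) (*-monoʳ-≤ (6 * m) (below-node p∉ x-at)))
              (potential-children cs _ (At-children x-at))

    potential-children : ∀ {h} (cs : List (HST n h)) f → ChildrenAt cs f →
                         localCostL C0 cs + 6 * m * sum (applyUpTo (below ∘ f) (length cs)) ≤ nodeBound (node cs)
    potential-children []       _ _     = ≤-reflexive (trans (*-zeroʳ (6 * m)) (sym (*-zeroʳ (6 * m))))
    potential-children (c ∷ cs) f cs-at = begin
        childCost C0 c + localCostL C0 cs + 6 * m * (below (f 0) + rest)
          ≡⟨ regroup (childCost C0 c) (localCostL C0 cs) m (below (f 0)) rest ⟩
        (childCost C0 c + 6 * m * below (f 0)) + (localCostL C0 cs + 6 * m * rest)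
          ≤⟨ +-mono-≤ (potential-child c (f 0) (ChildrenAt-head cs-at))
                      (potential-children cs (f ∘ suc) (ChildrenAt-tail cs-at)) ⟩
        bound c + nodeBound (node cs)
          ≡⟨ cong (bound c +_) (nodeBound-node cs) ⟩
        bound c + sum (map bound cs)
          ≡⟨ nodeBound-node (c ∷ cs) ⟨
        nodeBound (node (c ∷ cs)) ∎
      where
      open ≤-Reasoning
      rest = sum (applyUpTo (below ∘ f ∘ suc) (length cs))
      regroup : ∀ a b k x y → a + b + 6 * k * (x + y) ≡ (a + 6 * k * x) + (b + 6 * k * y)
      regroup = solve-∀

    potential-child : ∀ {h} (c : HST n h) q → At c q → childCost C0 c + 6 * m * below q ≤ bound c
    potential-child c q c-at with below q ≟ 0
    ... | yes none = begin
        childCost C0 c + 6 * m * below q ≡⟨ cong (λ a → childCost C0 c + 6 * m * a) none ⟩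
        childCost C0 c + 6 * m * 0        ≡⟨ cong (childCost C0 c +_) (*-zeroʳ (6 * m)) ⟩
        childCost C0 c + 0                ≡⟨ +-identityʳ _ ⟩
        childCost C0 c                    ≤⟨ light-bound c (below≡0⇒light c-at none) ⟩
        bound c                           ∎
      where open ≤-Reasoning
    ... | no some with toSum (meets? F c)
    ...   | inj₁ meets-F = begin
        childCost C0 c + 6 * m * below q ≡⟨ cong (_+ 6 * m * below q) (childCost-meets c meets-C0) ⟩
        localCost C0 c + 6 * m * below q ≤⟨ potential c q c-at meets-F ⟩
        nodeBound c                       ≡⟨ bound-meets c meets-F ⟨
        bound c                           ∎
      where
      open ≤-Reasoning
      meets-C0 = below≥1⇒Meets c c-at (n≢0⇒n>0 some)
    ...   | inj₂ ¬meets-F = heavy-bound c q c-at (below≥1⇒Meets c c-at (n≢0⇒n>0 some)) ¬meets-F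

    -- A child containing selected nodes but no point of F: its weight pays for both the local
    -- cost and the bonuses, because F has to reach it from the level above.
    heavy-bound : ∀ {h} (c : HST n h) q → At c q → Meets C0 c → ¬ Meets F c →
                  childCost C0 c + 6 * m * below q ≤ bound c
    heavy-bound {h} c q c-at meets-C0 ¬meets-F = begin
        childCost C0 c + 6 * m * below q
          ≡⟨ cong₂ _+_ (childCost-meets c meets-C0)
                       (trans (*-assoc 6 m (below q)) (cong (6 *_) (*-comm m (below q)))) ⟩
        localCost C0 c + 6 * (below q * m)
          ≤⟨ +-mono-≤ (≤-trans (localCost≤ C0 c) (*-monoʳ-≤ (N c) (lcaDist≤ h)))
                      (*-monoʳ-≤ 6 (heavy c q c-at)) ⟩
        N c * (2 * 2 ^ h) + 6 * (N c * 2 ^ h)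
          ≡⟨ regroup (N c) (2 ^ h) ⟩
        4 * (N c * (2 * 2 ^ h))
          ≤⟨ *-monoʳ-≤ 4 (*-monoʳ-≤ (N c) (2*2^≤lcaDist-suc h)) ⟩
        4 * (N c * lcaDist (suc h))
          ≡⟨ bound-misses c ¬meets-F ⟨
        bound c ∎
      where
      open ≤-Reasoning
      regroup : ∀ a b → a * (2 * b) + 6 * (a * b) ≡ 4 * (a * (2 * b))
      regroup = solve-∀

  localCost≤4*localCost : Meets F t → countIn F (leaves t) ≤ length C1 → localCost C0 t ≤ 4 * localCost F t
  localCost≤4*localCost meets F≤C1 = +-cancelʳ-≤ (6 * m * below []) (localCost C0 t) (4 * localCost F t) (begin
      localCost C0 t + 6 * m * below []                ≤⟨ potential t [] At-root meets ⟩
      4 * localCost F t + 6 * m * countIn F (leaves t) ≤⟨ +-monoʳ-≤ _ (*-monoʳ-≤ (6 * m) F≤below) ⟩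
      4 * localCost F t + 6 * m * below []              ∎)
    where
    open ≤-Reasoning
    F≤below = ≤-trans F≤C1 (≤-reflexive (sym below-root))

separating-threshold : ∀ {n L} {t : HST n L} {C v₀} → DominantAntichain t C → v₀ ∈ C →
                       ∃ λ m → (∀ {v} → v ∈ C → m ≤ score t v) ×
                               (∀ {u} → IsNode t u → (∀ {v} → v ∈ C → ¬ u ⊑ v) → score t u ≤ m)
separating-threshold {t = t} {C} {v₀} inv v₀∈ =
  score t v* , All.lookup (f[argmin]≤f[xs] {f = score t} v₀ C) , λ node-u none → dominant node-u none v*∈
  where
  open DominantAntichain inv
  v* = argmin (score t) v₀ C
  v*∈ : v* ∈ C
  v*∈ = argmin-all (score t) v₀∈ (All.tabulate (λ v∈ → v∈))

mainTheorem3 : ∀ {n : ℕ} (ρ : Fin n → Fin n → ℚ) (L : ℕ) (Δ : ℚ) →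
    IsMetric ρ → MinDistOne ρ → Diameter ρ Δ → Δ ≡ ℕ→ℚ (2 ^ L) →
    (t : HST n L) → Is2HST ρ Δ t →
    (k : ℕ) → 1 ≤ k → k ≤ n →
    (C1 : List Path) → SubtreeSearch t k C1 →
    (C0 : List (Fin n)) → LeafSearch t C1 C0 →
    (F : List (Fin n)) → Unique F → length F ≡ k →
    costT t C0 ≤ 10 * costT t F
mainTheorem3 _ _ _ _ _ _ _ t is2HST k k≥1 _ C1 (run , C1≮k) C0 leafSearch F _ |F|≡k = begin
    costT t C0         ≡⟨ costT≡localCost t bij (Meets-root t bij (proj₂ some-C0)) ⟩
    localCost C0 t     ≤⟨ localCost≤4*localCost (Meets-root t bij (proj₂ some-F)) F≤C1 ⟩
    4 * localCost F t  ≡⟨ cong (4 *_) (costT≡localCost t bij (Meets-root t bij (proj₂ some-F))) ⟨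
    4 * costT t F      ≤⟨ *-monoˡ-≤ (costT t F) (m≤m+n 4 6) ⟩
    10 * costT t F     ∎
  where
  open ≤-Reasoning
  bij = Is2HST.leavesBij is2HST
  k≤C1 = ≮⇒≥ C1≮k
  some-C1 = length≥1⇒∃∈ (≤-trans k≥1 k≤C1)
  some-C0 = length≥1⇒∃∈ {xs = C0}
              (≤-trans k≥1 (≤-trans k≤C1 (≤-reflexive (Pointwise-length leafSearch))))
  some-F  = length≥1⇒∃∈ {xs = F} (≤-trans k≥1 (≤-reflexive (sym |F|≡k)))
  threshold = separating-threshold (run-invariant run) (proj₂ some-C1)
  open Potential t (run-invariant run) leafSearch
                 (proj₁ threshold) (proj₁ (proj₂ threshold)) (proj₂ (proj₂ threshold))
  F≤C1 : countIn F (leaves t) ≤ length C1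
  F≤C1 = ≤-trans (countIn≤length F (Unique-leaves {t = t} bij)) (≤-trans (≤-reflexive |F|≡k) k≤C1)
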